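{- For any spanoids $\mathcal S_1,\mathcal S_2$ on finite sets $X_1,X_2$, $\mathrm{rank}(\mathcal S_1\ltimes\mathcal S_2)=\mathrm{rank}(\mathcal S_1)\,\mathrm{rank}(\mathcal S_2)$.
   Context: A spanoid $\mathcal S$ on a finite set $X$ is a family of pairs $(S,i)$ with $S\subseteq X$, $i\in X$ (rules). For $T\subseteq X$, $i\in X$ write $T\models i$ if there is a sequence $T=T_0,\dots,T_r$ ($r\ge0$) with $i\in T_r$ such that for each $j\in[r]$, $T_j=T_{j-1}\cup\{i_j\}$ where some $S\subseteq T_{j-1}$ has $(S,i_j)\in\mathcal S$. $\mathrm{span}(T)=\{i:T\models i\}$; $\mathrm{rank}(\mathcal S)$ is the minimum size of $T$ with $\mathrm{span}(T)=X$. The semi-direct product $\mathcal S_1\ltimes\mathcal S_2$ is the spanoid on $X_1\times X_2$ with the rules: (1) for $A\subseteq X_1$, $i\in X_1$ with $A\models i$ in $\mathcal S_1$, and every $j\in X_2$, the rule $A\times X_2\to(i,j)$; (2) for $B\subseteq X_2$, $j\in X_2$ with $B\models j$ in $\mathcal S_2$, and every $i\in X_1$, the rule $\{i\}\times B\to(i,j)$. -}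

module Defs where

open import Data.Nat using (ℕ; _*_; _≤_)
open import Data.Fin using (Fin; combine)
open import Data.Fin.Subset using (Subset; _∈_; _⊆_; _∪_; ⁅_⁆; ∣_∣; ⊤)
open import Data.Product using (Σ; ∃; ∃-syntax; _×_; _,_)
open import Relation.Binary.PropositionalEquality using (_≡_)
open import Function.Bundles using (_⇔_)

-- A spanoid on the finite set X = Fin n: the family of its rules (S , i),
-- given as a predicate  Rule S i  ("(S , i) ∈ 𝒮").
Spanoid : ℕ → Set₁
Spanoid n = Subset n → Fin n → Set

module _ {n : ℕ} (𝒮 : Spanoid n) where

  data Reaches (T : Subset n) : Subset n → Set where
    start : Reaches T T
    step  : ∀ {U S k} → Reaches T U → S ⊆ U → 𝒮 S k → Reaches T (U ∪ ⁅ k ⁆)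

  Derives : Subset n → Fin n → Set
  Derives T i = ∃[ U ] (Reaches T U × i ∈ U)

  Spanning : Subset n → Set
  Spanning T = ∀ i → Derives T i

  IsRank : ℕ → Set
  IsRank r = (∃[ T ] (Spanning T × ∣ T ∣ ≡ r)) × (∀ T → Spanning T → r ≤ ∣ T ∣)

-- Semi-direct product on X₁ × X₂, with X₁ × X₂ encoded as Fin (n₁ * n₂)
-- via the bijection  combine : Fin n₁ → Fin n₂ → Fin (n₁ * n₂).
_⋉_ : ∀ {n₁ n₂} → Spanoid n₁ → Spanoid n₂ → Spanoid (n₁ * n₂)
_⋉_ {n₁} {n₂} 𝒮₁ 𝒮₂ P k =
    -- rule (1): A × X₂ → (i , j) whenever A ⊨ i in 𝒮₁
    (Σ (Subset n₁) λ A → Σ (Fin n₁) λ i → Σ (Fin n₂) λ j →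
       Derives 𝒮₁ A i × k ≡ combine i j ×
       (∀ i' j' → (combine i' j' ∈ P) ⇔ (i' ∈ A)))
  ⊎′
    -- rule (2): {i} × B → (i , j) whenever B ⊨ j in 𝒮₂
    (Σ (Subset n₂) λ B → Σ (Fin n₁) λ i → Σ (Fin n₂) λ j →
       Derives 𝒮₂ B j × k ≡ combine i j ×
       (∀ i' j' → (combine i' j' ∈ P) ⇔ (i' ≡ i × j' ∈ B)))
  where open import Data.Sum using () renaming (_⊎_ to _⊎′_)

module Submission where

-- Upper bound: if T₁ spans 𝒮₁ and T₂ spans 𝒮₂ then T₁ × T₂ spans the product.
-- Every point (a , b) with a ∈ T₁ is derived from the row {a} × T₂ by a rule
-- of type (2); then T₁ × X₂ derives every (i , j) by a rule of type (1).
--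
-- Lower bound: let T span the product and cut it into rows T = ⋃ᵢ {i} × Tᵢ.
-- Call i rich if |Tᵢ| ≥ rank 𝒮₂, and let A be the set of rich indices, so
-- that |T| ≥ |A| · rank 𝒮₂.  By induction along derivations, every point
-- (i , j) derived from T is explained: A ⊨ i in 𝒮₁ or Tᵢ ⊨ j in 𝒮₂.  If a
-- whole line {i} × X₂ is explained then A ⊨ i (otherwise Tᵢ spans 𝒮₂, so i is
-- rich).  Hence A spans 𝒮₁, |A| ≥ rank 𝒮₁ and |T| ≥ rank 𝒮₁ · rank 𝒮₂.

open import Defs
open import Data.Nat using (ℕ; _*_; _+_; _≤_; _≤?_; z≤n)
open import Data.Nat.Properties using (+-mono-≤; *-monoˡ-≤; m≤n+m; ≤-trans; module ≤-Reasoning)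
open import Data.Bool using (true; false)
open import Data.Fin using (Fin; combine)
open import Data.Fin.Properties using (combine-surjective; combine-injective)
open import Data.Fin.Subset using (Subset; _∈_; _⊆_; _∪_; ⁅_⁆; ∣_∣; ⊤; ⊥)
open import Data.Fin.Subset.Properties
  using (_∈?_; q⊆p∪q; x∈p∪q⁻; x∈p∪q⁺; x∈⁅x⁆; x∈⁅y⁆⇒x≡y; ∉⊥; ∈⊤; ∣⊥∣≡0)
open import Data.Vec using (Vec; []; _∷_; _++_; concat; lookup; group; here; there)
open import Data.Vec.Properties using (lookup-concat; []=⇒lookup; lookup⇒[]=)
open import Data.List using (List; []; _∷_; allFin)
open import Data.List.Membership.Propositional using () renaming (_∈_ to _∈ₗ_)
open import Data.List.Membership.Propositional.Properties using (∈-allFin)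
open import Data.List.Relation.Unary.Any using (here; there)
open import Data.Product using (∃-syntax; _×_; _,_; proj₁)
open import Data.Sum using (_⊎_; inj₁; inj₂; map₁)
open import Data.Empty using (⊥-elim)
open import Relation.Nullary using (yes; no)
open import Relation.Binary.PropositionalEquality using (_≡_; refl; sym; trans; subst)
open import Function.Bundles using (_⇔_; mk⇔; Equivalence)

open Equivalence using (to; from)

SpanningLowerBound : ∀ {n} → Spanoid n → ℕ → Set
SpanningLowerBound 𝒮 r = ∀ T → Spanning 𝒮 T → r ≤ ∣ T ∣

module Derivations {n : ℕ} (𝒮 : Spanoid n) where

  reaches-⊆ : ∀ {T U} → Reaches 𝒮 T U → T ⊆ U
  reaches-⊆ start x∈T = x∈T
  reaches-⊆ (step r _ _) x∈T = x∈p∪q⁺ (inj₁ (reaches-⊆ r x∈T))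

  reaches-trans : ∀ {T U V} → Reaches 𝒮 T U → Reaches 𝒮 U V → Reaches 𝒮 T V
  reaches-trans r start = r
  reaches-trans r (step r′ S⊆U rule) = step (reaches-trans r r′) S⊆U rule

  reaches-lift : ∀ {T U V} → Reaches 𝒮 T U → T ⊆ V → ∃[ W ] (Reaches 𝒮 V W × U ⊆ W)
  reaches-lift {V = V} start T⊆V = V , start , T⊆V
  reaches-lift (step {U} {k = k} r S⊆U rule) T⊆V with reaches-lift r T⊆V
  ... | W , r′ , U⊆W =
    W ∪ ⁅ k ⁆ , step r′ (λ x∈S → U⊆W (S⊆U x∈S)) rule ,
    λ x∈U∪k → x∈p∪q⁺ (map₁ U⊆W (x∈p∪q⁻ U ⁅ k ⁆ x∈U∪k))

  gather : ∀ {A B} (xs : List (Fin n)) → (∀ {x} → x ∈ B → Derives 𝒮 A x) →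
           ∃[ U ] (Reaches 𝒮 A U × (∀ {x} → x ∈ₗ xs → x ∈ B → x ∈ U))
  gather [] _ = _ , start , λ ()
  gather {B = B} (y ∷ xs) A⊨B with gather xs A⊨B | y ∈? B
  ... | U , r , covered | no y∉B =
    U , r , λ { (here refl) y∈B → ⊥-elim (y∉B y∈B) ; (there x∈xs) → covered x∈xs }
  ... | U , r , covered | yes y∈B with A⊨B y∈B
  ...   | V , r′ , y∈V with reaches-lift r′ (reaches-⊆ r)
  ...     | W , r″ , V⊆W =
    W , reaches-trans r r″ ,
    λ { (here refl) _ → V⊆W y∈V ; (there x∈xs) x∈B → reaches-⊆ r″ (covered x∈xs x∈B) }

  derives-trans : ∀ {A B i} → (∀ {x} → x ∈ B → Derives 𝒮 A x) → Derives 𝒮 B i → Derives 𝒮 A i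
  derives-trans A⊨B (V , r , i∈V) with gather (allFin n) A⊨B
  ... | U , r′ , covered with reaches-lift r (λ x∈B → covered (∈-allFin _) x∈B)
  ... | W , r″ , V⊆W = W , reaches-trans r′ r″ , V⊆W i∈V

  derives-∈ : ∀ {T i} → i ∈ T → Derives 𝒮 T i
  derives-∈ i∈T = _ , start , i∈T

  derives-rule : ∀ {S T k} → S ⊆ T → 𝒮 S k → Derives 𝒮 T k
  derives-rule {T = T} {k} S⊆T rule = T ∪ ⁅ k ⁆ , step start S⊆T rule , q⊆p∪q T ⁅ k ⁆ (x∈⁅x⁆ k)

  derives-induction : ∀ {T i} (P : Fin n → Set) → (∀ {x} → x ∈ T → P x) →
                      (∀ {S k} → (∀ {x} → x ∈ S → P x) → 𝒮 S k → P k) →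
                      Derives 𝒮 T i → P i
  derives-induction {T} P base closed (_ , r , i∈U) = reached r i∈U
    where
    reached : ∀ {U x} → Reaches 𝒮 T U → x ∈ U → P x
    reached start x∈T = base x∈T
    reached (step {U} {k = k} r S⊆U rule) x∈U∪k with x∈p∪q⁻ U ⁅ k ⁆ x∈U∪k
    ... | inj₁ x∈U = reached r x∈U
    ... | inj₂ x∈⁅k⁆ rewrite x∈⁅y⁆⇒x≡y k x∈⁅k⁆ = closed (λ x∈S → reached r (S⊆U x∈S)) rule

open Derivations

common-disjunct : ∀ {k} {P : Set} {Q : Fin k → Set} (B : Subset k) →
                  (∀ {j} → j ∈ B → P ⊎ Q j) → P ⊎ (∀ {j} → j ∈ B → Q j)
common-disjunct [] _ = inj₂ λ ()
common-disjunct {Q = Q} (false ∷ B) h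
  with common-disjunct {Q = λ j → Q (Fin.suc j)} B (λ j∈B → h (there j∈B))
... | inj₁ p = inj₁ p
... | inj₂ q = inj₂ λ { (there j∈B) → q j∈B }
common-disjunct {Q = Q} (true ∷ B) h
  with h here | common-disjunct {Q = λ j → Q (Fin.suc j)} B (λ j∈B → h (there j∈B))
... | inj₁ p | _ = inj₁ p
... | inj₂ _ | inj₁ p = inj₁ p
... | inj₂ q₀ | inj₂ q = inj₂ λ { here → q₀ ; (there j∈B) → q j∈B }

pair-elim : ∀ {m k} {P : Fin (m * k) → Set} → (∀ i j → P (combine i j)) → ∀ x → P x
pair-elim {m} {k} h x with combine-surjective {m} {k} x
... | i , j , refl = h i j

∈-concat : ∀ {m k} (rows : Vec (Subset k) m) i j → combine i j ∈ concat rows ⇔ j ∈ lookup rows i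
∈-concat rows i j = mk⇔
  (λ ij∈ → lookup⇒[]= j _ (trans (sym (lookup-concat rows i j)) ([]=⇒lookup ij∈)))
  (λ j∈ → lookup⇒[]= (combine i j) _ (trans (lookup-concat rows i j) ([]=⇒lookup j∈)))

∣++∣ : ∀ {m k} (X : Subset m) (Y : Subset k) → ∣ X ++ Y ∣ ≡ ∣ X ∣ + ∣ Y ∣
∣++∣ [] Y = refl
∣++∣ (true ∷ X) Y rewrite ∣++∣ X Y = refl
∣++∣ (false ∷ X) Y = ∣++∣ X Y

⊠-rows : ∀ {m k} → Subset m → Subset k → Vec (Subset k) m
⊠-rows [] Y = []
⊠-rows (true ∷ X) Y = Y ∷ ⊠-rows X Y
⊠-rows (false ∷ X) Y = ⊥ ∷ ⊠-rows X Y

_⊠_ : ∀ {m k} → Subset m → Subset k → Subset (m * k)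
X ⊠ Y = concat (⊠-rows X Y)

∈-⊠ : ∀ {m k} (X : Subset m) (Y : Subset k) i j → combine i j ∈ X ⊠ Y ⇔ (i ∈ X × j ∈ Y)
∈-⊠ X Y i j = mk⇔ (λ ij∈ → in-row X i (to (∈-concat (⊠-rows X Y) i j) ij∈))
                  (λ { (i∈X , j∈Y) → from (∈-concat (⊠-rows X Y) i j) (row-∋ X i∈X j∈Y) })
  where
  in-row : ∀ {m} (X : Subset m) i → j ∈ lookup (⊠-rows X Y) i → i ∈ X × j ∈ Y
  in-row (true ∷ X) Fin.zero j∈Y = here , j∈Y
  in-row (false ∷ X) Fin.zero j∈⊥ = ⊥-elim (∉⊥ j∈⊥)
  in-row (true ∷ X) (Fin.suc i) j∈row with in-row X i j∈row
  ... | i∈X , j∈Y = there i∈X , j∈Y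
  in-row (false ∷ X) (Fin.suc i) j∈row with in-row X i j∈row
  ... | i∈X , j∈Y = there i∈X , j∈Y
  row-∋ : ∀ {m} (X : Subset m) {i} → i ∈ X → j ∈ Y → j ∈ lookup (⊠-rows X Y) i
  row-∋ (true ∷ X) here j∈Y = j∈Y
  row-∋ (true ∷ X) (there i∈X) j∈Y = row-∋ X i∈X j∈Y
  row-∋ (false ∷ X) (there i∈X) j∈Y = row-∋ X i∈X j∈Y

∣⊠∣ : ∀ {m k} (X : Subset m) (Y : Subset k) → ∣ X ⊠ Y ∣ ≡ ∣ X ∣ * ∣ Y ∣
∣⊠∣ [] Y = refl
∣⊠∣ (true ∷ X) Y rewrite ∣++∣ Y (X ⊠ Y) | ∣⊠∣ X Y = refl
∣⊠∣ {k = k} (false ∷ X) Y rewrite ∣++∣ (⊥ {k}) (X ⊠ Y) | ∣⊥∣≡0 k = ∣⊠∣ X Y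

⁅⁆-⊆ : ∀ {m} {X : Subset m} {a} → a ∈ X → ⁅ a ⁆ ⊆ X
⁅⁆-⊆ {X = X} {a} a∈X y∈⁅a⁆ = subst (_∈ X) (sym (x∈⁅y⁆⇒x≡y a y∈⁅a⁆)) a∈X

⊠-mono : ∀ {m k} {X X′ : Subset m} {Y Y′ : Subset k} → X ⊆ X′ → Y ⊆ Y′ → X ⊠ Y ⊆ X′ ⊠ Y′
⊠-mono {X = X} {X′} {Y} {Y′} X⊆X′ Y⊆Y′ {x} = pair-elim {P = λ x → x ∈ X ⊠ Y → x ∈ X′ ⊠ Y′}
  (λ i j ij∈ → let (i∈X , j∈Y) = to (∈-⊠ X Y i j) ij∈
               in from (∈-⊠ X′ Y′ i j) (X⊆X′ i∈X , Y⊆Y′ j∈Y)) x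

rich : ∀ {m k} → ℕ → Vec (Subset k) m → Subset m
rich r [] = []
rich r (row ∷ rows) with r ≤? ∣ row ∣
... | yes _ = true ∷ rich r rows
... | no _ = false ∷ rich r rows

∈-rich : ∀ {m k} r (rows : Vec (Subset k) m) {i} → r ≤ ∣ lookup rows i ∣ → i ∈ rich r rows
∈-rich r (row ∷ rows) {i} r≤∣row∣ with r ≤? ∣ row ∣ | i
... | yes _ | Fin.zero = here
... | no r≰∣row∣ | Fin.zero = ⊥-elim (r≰∣row∣ r≤∣row∣)
... | yes _ | Fin.suc i′ = there (∈-rich r rows r≤∣row∣)
... | no _ | Fin.suc i′ = there (∈-rich r rows r≤∣row∣)

∣rich∣ : ∀ {m k} r (rows : Vec (Subset k) m) → ∣ rich r rows ∣ * r ≤ ∣ concat rows ∣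
∣rich∣ r [] = z≤n
∣rich∣ r (row ∷ rows) with r ≤? ∣ row ∣
... | yes r≤∣row∣ = begin
  r + ∣ rich r rows ∣ * r         ≤⟨ +-mono-≤ r≤∣row∣ (∣rich∣ r rows) ⟩
  ∣ row ∣ + ∣ concat rows ∣       ≡⟨ ∣++∣ row (concat rows) ⟨
  ∣ row ++ concat rows ∣          ∎
  where open ≤-Reasoning
... | no _ = begin
  ∣ rich r rows ∣ * r             ≤⟨ ∣rich∣ r rows ⟩
  ∣ concat rows ∣                 ≤⟨ m≤n+m _ ∣ row ∣ ⟩
  ∣ row ∣ + ∣ concat rows ∣       ≡⟨ ∣++∣ row (concat rows) ⟨
  ∣ row ++ concat rows ∣          ∎
  where open ≤-Reasoning

module SemiDirect {n₁ n₂ : ℕ} (𝒮₁ : Spanoid n₁) (𝒮₂ : Spanoid n₂) where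

  𝒫 : Spanoid (n₁ * n₂)
  𝒫 = 𝒮₁ ⋉ 𝒮₂

  rule₁ : ∀ {A i} j → Derives 𝒮₁ A i → 𝒫 (A ⊠ ⊤) (combine i j)
  rule₁ {A} {i} j A⊨i = inj₁ (A , i , j , A⊨i , refl , λ i′ j′ → mk⇔
    (λ ij∈ → proj₁ (to (∈-⊠ A ⊤ i′ j′) ij∈))
    (λ i′∈A → from (∈-⊠ A ⊤ i′ j′) (i′∈A , ∈⊤)))

  rule₂ : ∀ {B j} i → Derives 𝒮₂ B j → 𝒫 (⁅ i ⁆ ⊠ B) (combine i j)
  rule₂ {B} {j} i B⊨j = inj₂ (B , i , j , B⊨j , refl , λ i′ j′ → mk⇔
    (λ ij∈ → let (i′∈⁅i⁆ , j′∈B) = to (∈-⊠ ⁅ i ⁆ B i′ j′) ij∈ in x∈⁅y⁆⇒x≡y i i′∈⁅i⁆ , j′∈B)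
    (λ { (refl , j′∈B) → from (∈-⊠ ⁅ i ⁆ B i j′) (x∈⁅x⁆ i , j′∈B) }))

  ⊠-spanning : ∀ {T₁ T₂} → Spanning 𝒮₁ T₁ → Spanning 𝒮₂ T₂ → Spanning 𝒫 (T₁ ⊠ T₂)
  ⊠-spanning {T₁} {T₂} T₁-spans T₂-spans =
    pair-elim λ i j → derives-trans 𝒫 covers (derives-rule 𝒫 (λ x∈ → x∈) (rule₁ j (T₁-spans i)))
    where
    -- T₁ × X₂ is derived row by row from T₁ × T₂ using rule (2).
    covers : ∀ {x} → x ∈ T₁ ⊠ ⊤ → Derives 𝒫 (T₁ ⊠ T₂) x
    covers {x} = pair-elim {P = λ x → x ∈ T₁ ⊠ ⊤ → Derives 𝒫 (T₁ ⊠ T₂) x} (λ a b ab∈ →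
      let a∈T₁ = proj₁ (to (∈-⊠ T₁ ⊤ a b) ab∈)
      in derives-rule 𝒫 (⊠-mono (⁅⁆-⊆ a∈T₁) (λ y∈ → y∈)) (rule₂ a (T₂-spans b))) x

  module Rows (rows : Vec (Subset n₂) n₁) {r₂ : ℕ} (r₂-bound : SpanningLowerBound 𝒮₂ r₂) where

    A : Subset n₁
    A = rich r₂ rows

    Explained : Fin n₁ → Fin n₂ → Set
    Explained i j = Derives 𝒮₁ A i ⊎ Derives 𝒮₂ (lookup rows i) j

    -- The same property for a point of Fin (n₁ * n₂), in a form suited to
    -- induction along derivations.
    ExplainedAt : Fin (n₁ * n₂) → Set
    ExplainedAt x = ∀ i j → x ≡ combine i j → Explained i j

    -- If the whole line {i} × X₂ is explained then A ⊨ i: otherwise row i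
    -- spans 𝒮₂, so it is rich and i ∈ A.
    line-derivable : ∀ {i} → (∀ j → Explained i j) → Derives 𝒮₁ A i
    line-derivable {i} explained with common-disjunct ⊤ (λ {j} _ → explained j)
    ... | inj₁ A⊨i = A⊨i
    ... | inj₂ row⊨ = derives-∈ 𝒮₁ (∈-rich r₂ rows (r₂-bound _ (λ j → row⊨ ∈⊤)))

    explained-closed : ∀ {S k} → (∀ {x} → x ∈ S → ExplainedAt x) → 𝒫 S k → ExplainedAt k
    explained-closed H (inj₁ (A′ , i₀ , j₀ , A′⊨i₀ , refl , S≈A′×X₂)) i j eq
      with combine-injective i j i₀ j₀ (sym eq)
    ... | refl , refl = inj₁ (derives-trans 𝒮₁ A⊨A′ A′⊨i₀)
      where
      A⊨A′ : ∀ {x} → x ∈ A′ → Derives 𝒮₁ A x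
      A⊨A′ {x} x∈A′ = line-derivable λ j′ → H (from (S≈A′×X₂ x j′) x∈A′) x j′ refl
    explained-closed H (inj₂ (B , i₀ , j₀ , B⊨j₀ , refl , S≈i₀×B)) i j eq
      with combine-injective i j i₀ j₀ (sym eq)
    ... | refl , refl with common-disjunct B (λ {y} y∈B → H (from (S≈i₀×B i y) (refl , y∈B)) i y refl)
    ... | inj₁ A⊨i = inj₁ A⊨i
    ... | inj₂ row⊨B = inj₂ (derives-trans 𝒮₂ row⊨B B⊨j₀)

    rich-spanning : Spanning 𝒫 (concat rows) → Spanning 𝒮₁ A
    rich-spanning spans i = line-derivable λ j →
      derives-induction 𝒫 ExplainedAt base explained-closed (spans (combine i j)) i j refl
      where
      base : ∀ {x} → x ∈ concat rows → ExplainedAt x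
      base x∈ i j refl = inj₂ (derives-∈ 𝒮₂ (to (∈-concat rows i j) x∈))

  product-bound : ∀ {r₁ r₂} → SpanningLowerBound 𝒮₁ r₁ → SpanningLowerBound 𝒮₂ r₂ →
                  SpanningLowerBound 𝒫 (r₁ * r₂)
  product-bound {r₁} {r₂} r₁-bound r₂-bound T spans with group n₁ n₂ T
  ... | rows , refl = ≤-trans (*-monoˡ-≤ r₂ (r₁-bound _ (rich-spanning spans))) (∣rich∣ r₂ rows)
    where open Rows rows r₂-bound

open SemiDirect

mainTheorem18 : ∀ {n₁ n₂ : ℕ} (𝒮₁ : Spanoid n₁) (𝒮₂ : Spanoid n₂) (r₁ r₂ : ℕ) →
    IsRank 𝒮₁ r₁ → IsRank 𝒮₂ r₂ → IsRank (𝒮₁ ⋉ 𝒮₂) (r₁ * r₂)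
mainTheorem18 𝒮₁ 𝒮₂ r₁ r₂ ((T₁ , T₁-spans , refl) , r₁-bound) ((T₂ , T₂-spans , refl) , r₂-bound) =
  (T₁ ⊠ T₂ , ⊠-spanning 𝒮₁ 𝒮₂ T₁-spans T₂-spans , ∣⊠∣ T₁ T₂) ,
  product-bound 𝒮₁ 𝒮₂ r₁-bound r₂-bound
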